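{- Let $V=\sum_{n\ge0}\sum_{\pi\in\mathcal R_{2n}}\mathbf G_\pi$ and $W=\sum_{n\ge0}\sum_{\pi\in\mathcal R_{2n+1}}\mathbf G_\pi$. Then $$V^{ -1}=\sum_{m\ge0}(-1)^m\mathbf G_{\tau_{2m}}=1-\mathbf G_{1\bar2}+\mathbf G_{1\bar23\bar4}-\mathbf G_{1\bar23\bar45\bar6}+\cdots,$$ $$W\,V^{ -1}=\sum_{m\ge0}(-1)^m\mathbf G_{\rho_{2m+1}}=\mathbf G_1-\mathbf G_{12\bar3}+\mathbf G_{12\bar34\bar5}-\mathbf G_{12\bar34\bar56\bar7}+\cdots,$$ where $\tau_{2m}$ is the signed permutation of size $2m$ with $|\tau_{2m}|$ the identity and $\tau_{2m}(i)<0$ iff $i$ is even, and $\rho_{2m+1}$ is the signed permutation of size $2m+1$ with $|\rho_{2m+1}|$ the identity and $\rho_{2m+1}(i)<0$ iff $i$ is odd and $i\ge3$.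
   Context: A signed permutation of size $n$ is a word $\pi=\pi_1\cdots\pi_n$ over the integers such that $|\pi_1|,\dots,|\pi_n|$ is a permutation of $\{1,\dots,n\}$ (written $(\sigma,\epsilon)$, $\pi_i=\epsilon_i\sigma(i)$); $-k$ is written $\bar k$; letters are compared as integers; $|\pi|=|\pi_1|\cdots|\pi_n|$. For a word $w$ of distinct integers, $\mathrm{std}(w)$ is the permutation with the same relative order. ${\bf FQSym}^{(2)}$ is the algebra with basis $\mathbf G_{(\sigma,\epsilon)}$ indexed by signed permutations of all sizes (unit $\mathbf G_\emptyset=1$), with product $\mathbf{G}_{(\alpha,\epsilon)}\mathbf{G}_{(\beta,\eta)}=\sum_{\gamma}\mathbf{G}_{(\gamma,\epsilon\cdot\eta)}$, the sum over $\gamma\in\mathfrak S_{k+l}$ with $\mathrm{std}(\gamma_1\cdots\gamma_k)=\alpha$, $\mathrm{std}(\gamma_{k+1}\cdots\gamma_{k+l})=\beta$ ($k,l$ the sizes), $\epsilon\cdot\eta$ the concatenation; formal infinite sums are allowed. $\mathcal R_{2n}$ is the set of signed permutations $\pi$ of size $2n$ such that $|\pi_1|<|\pi_2|>|\pi_3|<\cdots>|\pi_{2n-1}|<|\pi_{2n}|$ and, for every $1\le i\le 2n$, $\pi_i>0$ iff $i$ is odd ($\mathcal R_0$ consists of the empty permutation). $\mathcal R_{2n+1}$ is the set of signed permutations $\pi$ of size $2n+1$ such that $|\pi_1|>|\pi_2|<|\pi_3|>\cdots<|\pi_{2n+1}|$ (descents of $|\pi|$ exactly at the odd positions $1,3,\dots,2n-1$),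 $\pi_1>0$, and for every $2\le i\le 2n+1$, $\pi_i>0$ iff $i$ is even. -}

module Defs where

open import Data.Bool using (Bool; true; false; _∧_; _∨_; if_then_else_; T; not)
open import Data.Nat as ℕ using (ℕ; zero; suc; _≡ᵇ_; _<ᵇ_)
open import Data.Integer as ℤ using (ℤ; +_; -[1+_]; ∣_∣; -_; _*_)
open import Data.List using (List; []; _∷_; length; map; filter; take; drop; foldr; upTo)
open import Data.List.Properties using (≡-dec)
open import Relation.Nullary.Decidable using (⌊_⌋)
open import Relation.Binary.PropositionalEquality using (_≡_)

isPos : ℤ → Bool
isPos (+ zero)  = false
isPos (+ suc _) = true
isPos -[1+ _ ]  = false

countAbs : ℕ → List ℤ → ℕ
countAbs k []      = zero
countAbs k (x ∷ w) = if ∣ x ∣ ≡ᵇ k then suc (countAbs k w) else countAbs k w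

allᵇ : {A : Set} → (A → Bool) → List A → Bool
allᵇ p []      = true
allᵇ p (x ∷ l) = p x ∧ allᵇ p l

isSPerm : List ℤ → Bool
isSPerm w = allᵇ (λ i → countAbs (suc i) w ≡ᵇ 1) (upTo (length w))

IsSignedPerm : List ℤ → Set
IsSignedPerm w = T (isSPerm w)

-- For a signed permutation π, stdS (π_i … π_j) is the
-- signed permutation (std(|π_i| … |π_j|), (ε_i, …, ε_j)).
rankAbs : ℤ → List ℤ → ℕ
rankAbs x w = suc (length (filter (λ y → ∣ y ∣ ℕ.<? ∣ x ∣) w))

stdS : List ℤ → List ℤ
stdS w = map (λ x → if isPos x then + rankAbs x w else - (+ rankAbs x w)) w

-- FQSym^(2) with formal infinite sums: an element is its coefficient
-- function  π ↦ coefficient of G_π  (only values on signed permutations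
-- matter).

FQSym2 : Set
FQSym2 = List ℤ → ℤ

_≈_ : FQSym2 → FQSym2 → Set
A ≈ B = ∀ (w : List ℤ) → IsSignedPerm w → A w ≡ B w

sumℤ : List ℤ → ℤ
sumℤ = foldr ℤ._+_ (+ 0)

-- the product, extended bilinearly to formal sums: the coefficient of
-- G_(γ,ζ) in A·B is Σ_k A(std(γ₁…γ_k),ζ₁…ζ_k) · B(std(γ_{k+1}…γ_n),ζ_{k+1}…ζ_n)
_⋆_ : FQSym2 → FQSym2 → FQSym2
(A ⋆ B) w = sumℤ (map (λ k → A (stdS (take k w)) * B (stdS (drop k w))) (upTo (suc (length w))))

one : FQSym2
one []      = + 1
one (_ ∷ _) = + 0

evenᵇ : ℕ → Bool
evenᵇ zero          = true
evenᵇ (suc zero)    = false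
evenᵇ (suc (suc n)) = evenᵇ n

oddᵇ : ℕ → Bool
oddᵇ n = not (evenᵇ n)

_⇔ᵇ_ : Bool → Bool → Bool
true  ⇔ᵇ b = b
false ⇔ᵇ b = not b

-- asc i = true: |w_i| < |w_{i+1}|, otherwise |w_i| > |w_{i+1}|
-- (positions counted from i, starting at 1)
upDownOK : (ℕ → Bool) → ℕ → List ℤ → Bool
upDownOK asc i (x ∷ y ∷ r) =
  (if asc i then ∣ x ∣ <ᵇ ∣ y ∣ else ∣ y ∣ <ᵇ ∣ x ∣) ∧ upDownOK asc (suc i) (y ∷ r)
upDownOK asc i _ = true

signsOK : (ℕ → Bool) → ℕ → List ℤ → Bool
signsOK pos i []      = true
signsOK pos i (x ∷ r) = (pos i ⇔ᵇ isPos x) ∧ signsOK pos (suc i) r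

inREven : List ℤ → Bool
inREven w = isSPerm w ∧ evenᵇ (length w) ∧ upDownOK oddᵇ 1 w ∧ signsOK oddᵇ 1 w

inROdd : List ℤ → Bool
inROdd w = isSPerm w ∧ oddᵇ (length w) ∧ upDownOK evenᵇ 1 w
           ∧ signsOK (λ i → (i ≡ᵇ 1) ∨ evenᵇ i) 1 w

indicator : Bool → ℤ
indicator true  = + 1
indicator false = + 0

V : FQSym2
V w = indicator (inREven w)

W : FQSym2
W w = indicator (inROdd w)

signPow : ℕ → ℤ
signPow m = if evenᵇ m then + 1 else - (+ 1)

tau : ℕ → List ℤ
tau m = map (λ i → if evenᵇ (suc i) then - (+ suc i) else + suc i) (upTo (2 ℕ.* m))

rho : ℕ → List ℤ
rho m = map (λ i → if oddᵇ (suc i) ∧ (2 ℕ.<ᵇ suc i) then - (+ suc i) else + suc i)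
            (upTo (suc (2 ℕ.* m)))

_==_ : List ℤ → List ℤ → Bool
u == v = ⌊ ≡-dec ℤ._≟_ u v ⌋

half : ℕ → ℕ
half zero          = zero
half (suc zero)    = zero
half (suc (suc n)) = suc (half n)

TauSeries : FQSym2
TauSeries w = if w == tau (half (length w)) then signPow (half (length w)) else + 0

RhoSeries : FQSym2
RhoSeries w = if w == rho (half (length w)) then signPow (half (length w)) else + 0

-- A product A ⋆ B evaluated at a signed permutation w is a sum over the factorisations w = p s, and
-- the coefficients of V, W and Σ (−1)^m G_τ see std of a factor only through its shape: the ascents
-- of its absolute values and its signs.  Each identity thus becomes a sum over the factorisations
-- of a word with distinct absolute values, evaluated by induction on the word after peeling off
-- its first two letters a b.  The term p = ∅ survives only when the τ-shaped suffix a b w′ goes on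
-- above |b|; the terms p = a b p′ need p′ to start below |b|, and by induction they sum to minus
-- that same term.  W is a positive letter followed by an R_{2n}-shape, so W V⁻¹ reduces to the
-- same sums.

module Submission where

open import Algebra.Solver.CommutativeMonoid as ∧-Solver using ()
open import Data.Bool using (Bool; true; false; _∧_; _∨_; not; if_then_else_; T)
open import Data.Bool.Properties using (∧-commutativeMonoid; ∧-conicalˡ; not-involutive; T-∧; T-≡)
open import Data.Empty using (⊥-elim)
import Data.Fin as Fin
open import Data.Integer as ℤ using (ℤ; +_; -[1+_]; ∣_∣; -_; _*_; _+_)
import Data.Integer.Properties as ℤ
open import Data.List using (List; []; _∷_; length; map; filter; take; drop; upTo; applyUpTo)
open import Data.List.Properties using (≡-dec; length-filter; length-map; map-cong; map-applyUpTo)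
open import Data.List.Membership.Propositional using (_∈_)
open import Data.List.Membership.Propositional.Properties using (∈-upTo⁺; ∈-upTo⁻)
open import Data.List.Relation.Binary.Subset.Propositional using (_⊆_)
open import Data.List.Relation.Unary.All as All using (All; []; _∷_)
import Data.List.Relation.Unary.All.Properties as All
open import Data.List.Relation.Unary.AllPairs using (AllPairs; []; _∷_)
import Data.List.Relation.Unary.AllPairs.Properties as AllPairs
open import Data.List.Relation.Unary.Any using (here; there)
open import Data.List.Relation.Unary.Linked using (Linked; []; [-]; _∷_)
open import Data.List.Relation.Unary.Linked.Properties using (Linked⇒AllPairs)
open import Data.Nat as ℕ using (ℕ; zero; suc; _≤_; _<_; z≤n; s≤s; _≡ᵇ_; _<ᵇ_)
import Data.Nat.Properties as ℕ
open import Algebra.Properties.CommutativeSemigroup ℕ.+-commutativeSemigroup using () renaming (x∙yz≈y∙xz to +-exchange)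
open import Data.Product using (_×_; _,_; proj₁; proj₂)
open import Data.Vec using ([]; _∷_)
open import Function using (id; _∘_; _on_; Equivalence)
open import Relation.Binary using (tri<; tri≈; tri>)
open import Relation.Binary.PropositionalEquality
open import Relation.Nullary using (¬_; yes; no; _×-dec_)
open import Relation.Nullary.Reflects using (ofʸ; ofⁿ)

open import Defs

infix 4 _#_
infix 7 _≺_

_#_ : ℤ → ℤ → Set
x # y = ∣ x ∣ ≢ ∣ y ∣

Distinct : List ℤ → Set
Distinct = AllPairs _#_

_≺_ : ℤ → ℤ → Bool
x ≺ y = ∣ x ∣ <ᵇ ∣ y ∣

<ᵇ-true : ∀ {m n} → m < n → (m <ᵇ n) ≡ true
<ᵇ-true {m} {n} m<n with m <ᵇ n | ℕ.<ᵇ-reflects-< m n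
... | true  | _       = refl
... | false | ofⁿ m≮n = ⊥-elim (m≮n m<n)

<ᵇ-false : ∀ {m n} → ¬ m < n → (m <ᵇ n) ≡ false
<ᵇ-false {m} {n} m≮n with m <ᵇ n | ℕ.<ᵇ-reflects-< m n
... | false | _       = refl
... | true  | ofʸ m<n = ⊥-elim (m≮n m<n)

<ᵇ-flip : ∀ {m n} → m ≢ n → (n <ᵇ m) ≡ not (m <ᵇ n)
<ᵇ-flip {m} {n} m≢n with ℕ.<-cmp m n
... | tri< m<n _ n≮m = trans (<ᵇ-false n≮m) (cong not (sym (<ᵇ-true m<n)))
... | tri≈ _ m≡n _   = ⊥-elim (m≢n m≡n)
... | tri> m≮n _ n<m = trans (<ᵇ-true n<m) (cong not (sym (<ᵇ-false m≮n)))

≡ᵇ-true : ∀ {m n} → m ≡ n → (m ≡ᵇ n) ≡ true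
≡ᵇ-true {m} {n} m≡n = Equivalence.to T-≡ (ℕ.≡⇒≡ᵇ m n m≡n)

≡ᵇ-false : ∀ {m n} → m ≢ n → (m ≡ᵇ n) ≡ false
≡ᵇ-false {m} {n} m≢n with m ≡ᵇ n | ℕ.≡ᵇ⇒≡ m n
... | true  | ≡ᵇ⇒≡ = ⊥-elim (m≢n (≡ᵇ⇒≡ _))
... | false | _    = refl

evenᵇ-suc : ∀ n → evenᵇ (suc n) ≡ not (evenᵇ n)
evenᵇ-suc zero          = refl
evenᵇ-suc (suc zero)    = refl
evenᵇ-suc (suc (suc n)) = evenᵇ-suc n

oddᵇ-suc : ∀ n → oddᵇ (suc n) ≡ evenᵇ n
oddᵇ-suc n = trans (cong not (evenᵇ-suc n)) (not-involutive (evenᵇ n))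

signPow-suc : ∀ m → signPow (suc m) ≡ - signPow m
signPow-suc m rewrite evenᵇ-suc m with evenᵇ m
... | true  = refl
... | false = refl

-- Shapes

module _ (f g : ℕ → Bool) where

  private
    at-0 : ∀ {i k} → (∀ j → f (i ℕ.+ j) ≡ g (k ℕ.+ j)) → f i ≡ g k
    at-0 {i} {k} h = trans (cong f (sym (ℕ.+-identityʳ i))) (trans (h 0) (cong g (ℕ.+-identityʳ k)))

    at-suc : ∀ {i k} → (∀ j → f (i ℕ.+ j) ≡ g (k ℕ.+ j)) → ∀ j → f (suc i ℕ.+ j) ≡ g (suc k ℕ.+ j)
    at-suc {i} {k} h j = trans (cong f (sym (ℕ.+-suc i j))) (trans (h (suc j)) (cong g (ℕ.+-suc k j)))

  upDownOK-shift : ∀ i k → (∀ j → f (i ℕ.+ j) ≡ g (k ℕ.+ j)) → ∀ l → upDownOK f i l ≡ upDownOK g k l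
  upDownOK-shift i k h []          = refl
  upDownOK-shift i k h (x ∷ [])    = refl
  upDownOK-shift i k h (x ∷ y ∷ l) =
    cong₂ _∧_ (cong (λ t → if t then x ≺ y else y ≺ x) (at-0 h)) (upDownOK-shift (suc i) (suc k) (at-suc h) (y ∷ l))

  signsOK-shift : ∀ i k → (∀ j → f (i ℕ.+ j) ≡ g (k ℕ.+ j)) → ∀ l → signsOK f i l ≡ signsOK g k l
  signsOK-shift i k h []      = refl
  signsOK-shift i k h (x ∷ l) = cong₂ _∧_ (cong (_⇔ᵇ isPos x) (at-0 h)) (signsOK-shift (suc i) (suc k) (at-suc h) l)

-- R_{2n}, R_{2n+1}, τ_{2m} and ρ_{2m+1} are the signed
-- permutations of the four shapes below; shapes only see relative order and signs.
hasShape : (ℕ → Bool) → (ℕ → Bool) → (ℕ → Bool) → List ℤ → Bool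
hasShape len asc pos u = len (length u) ∧ upDownOK asc 1 u ∧ signsOK pos 1 u

rhoSigns : ℕ → Bool
rhoSigns i = (i ≡ᵇ 1) ∨ evenᵇ i

isREven isROdd isTau isRho : List ℤ → Bool
isREven = hasShape evenᵇ oddᵇ oddᵇ
isROdd  = hasShape oddᵇ evenᵇ rhoSigns
isTau   = hasShape evenᵇ (λ _ → true) oddᵇ
isRho   = hasShape oddᵇ (λ _ → true) rhoSigns

indREven tauCoeff rhoCoeff : List ℤ → ℤ
indREven u = indicator (isREven u)
tauCoeff u = if isTau u then signPow (half (length u)) else + 0
rhoCoeff u = if isRho u then signPow (half (length u)) else + 0

headAll headAny : (ℤ → Bool) → List ℤ → Bool
headAll c []      = true
headAll c (a ∷ _) = c a
headAny c []      = false
headAny c (a ∷ _) = c a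

isPosNegAscent : ℤ → ℤ → Bool
isPosNegAscent a b = a ≺ b ∧ isPos a ∧ not (isPos b)

private
  module ∧-CM = ∧-Solver ∧-commutativeMonoid

  ∧-interleave : ∀ e a z u p q s → e ∧ (a ∧ z ∧ u) ∧ (p ∧ q ∧ s) ≡ (a ∧ p ∧ q) ∧ z ∧ (e ∧ u ∧ s)
  ∧-interleave e a z u p q s =
    prove 7 (E ⊕ (A ⊕ Z ⊕ U) ⊕ (P ⊕ Q ⊕ S)) ((A ⊕ P ⊕ Q) ⊕ Z ⊕ (E ⊕ U ⊕ S)) (e ∷ a ∷ z ∷ u ∷ p ∷ q ∷ s ∷ [])
    where
    open ∧-CM
    E = var (Fin.# 0); A = var (Fin.# 1); Z = var (Fin.# 2); U = var (Fin.# 3)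
    P = var (Fin.# 4); Q = var (Fin.# 5); S = var (Fin.# 6)

  ∧-pull : ∀ o z u p s → o ∧ (z ∧ u) ∧ (p ∧ s) ≡ p ∧ z ∧ (o ∧ u ∧ s)
  ∧-pull o z u p s =
    prove 5 (O ⊕ (Z ⊕ U) ⊕ (P ⊕ S)) (P ⊕ Z ⊕ (O ⊕ U ⊕ S)) (o ∷ z ∷ u ∷ p ∷ s ∷ [])
    where
    open ∧-CM
    O = var (Fin.# 0); Z = var (Fin.# 1); U = var (Fin.# 2); P = var (Fin.# 3); S = var (Fin.# 4)

isREven-∷∷ : ∀ a b p → isREven (a ∷ b ∷ p) ≡ isPosNegAscent a b ∧ headAll (_≺ b) p ∧ isREven p
isREven-∷∷ a b []      = ∧-interleave true (a ≺ b) true true (isPos a) (not (isPos b)) true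
isREven-∷∷ a b (z ∷ r)
  rewrite upDownOK-shift oddᵇ oddᵇ 3 1 (λ _ → refl) (z ∷ r)
        | signsOK-shift oddᵇ oddᵇ 3 1 (λ _ → refl) (z ∷ r)
  = ∧-interleave (evenᵇ (length (z ∷ r))) (a ≺ b) (z ≺ b) (upDownOK oddᵇ 1 (z ∷ r))
                 (isPos a) (not (isPos b)) (signsOK oddᵇ 1 (z ∷ r))

isTau-∷∷ : ∀ a b p → isTau (a ∷ b ∷ p) ≡ isPosNegAscent a b ∧ headAll (b ≺_) p ∧ isTau p
isTau-∷∷ a b []      = ∧-interleave true (a ≺ b) true true (isPos a) (not (isPos b)) true
isTau-∷∷ a b (z ∷ r)
  rewrite upDownOK-shift (λ _ → true) (λ _ → true) 3 1 (λ _ → refl) (z ∷ r)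
        | signsOK-shift oddᵇ oddᵇ 3 1 (λ _ → refl) (z ∷ r)
  = ∧-interleave (evenᵇ (length (z ∷ r))) (a ≺ b) (b ≺ z) (upDownOK (λ _ → true) 1 (z ∷ r))
                 (isPos a) (not (isPos b)) (signsOK oddᵇ 1 (z ∷ r))

isROdd-∷ : ∀ a p → isROdd (a ∷ p) ≡ isPos a ∧ headAll (_≺ a) p ∧ isREven p
isROdd-∷ a []      = refl
isROdd-∷ a (z ∷ r)
  rewrite oddᵇ-suc (length (z ∷ r))
        | upDownOK-shift evenᵇ oddᵇ 2 1 (λ j → sym (oddᵇ-suc j)) (z ∷ r)
        | signsOK-shift rhoSigns oddᵇ 2 1 (λ j → sym (oddᵇ-suc j)) (z ∷ r)
  = ∧-pull (evenᵇ (length (z ∷ r))) (z ≺ a) (upDownOK oddᵇ 1 (z ∷ r)) (isPos a) (signsOK oddᵇ 1 (z ∷ r))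

isRho-∷ : ∀ a p → isRho (a ∷ p) ≡ isPos a ∧ headAll (a ≺_) p ∧ isTau p
isRho-∷ a []      = refl
isRho-∷ a (z ∷ r)
  rewrite oddᵇ-suc (length (z ∷ r))
        | upDownOK-shift (λ _ → true) (λ _ → true) 2 1 (λ _ → refl) (z ∷ r)
        | signsOK-shift rhoSigns oddᵇ 2 1 (λ j → sym (oddᵇ-suc j)) (z ∷ r)
  = ∧-pull (evenᵇ (length (z ∷ r))) (a ≺ z) (upDownOK (λ _ → true) 1 (z ∷ r)) (isPos a) (signsOK oddᵇ 1 (z ∷ r))

tauCoeff-∷∷ : ∀ a b p → tauCoeff (a ∷ b ∷ p) ≡ (if isPosNegAscent a b ∧ headAll (b ≺_) p then - tauCoeff p else + 0)
tauCoeff-∷∷ a b p rewrite isTau-∷∷ a b p | signPow-suc (half (length p))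
  with isPosNegAscent a b | headAll (b ≺_) p | isTau p
... | false | _     | _     = refl
... | true  | false | _     = refl
... | true  | true  | false = refl
... | true  | true  | true  = refl

half-suc-even : ∀ n → evenᵇ n ≡ true → half (suc n) ≡ half n
half-suc-even zero          _ = refl
half-suc-even (suc (suc n)) e = cong suc (half-suc-even n e)

rhoCoeff-∷ : ∀ a p → rhoCoeff (a ∷ p) ≡ (if isPos a ∧ headAll (a ≺_) p then tauCoeff p else + 0)
rhoCoeff-∷ a p rewrite isRho-∷ a p with isPos a | headAll (a ≺_) p | isTau p in τp
... | false | _     | _     = refl
... | true  | false | _     = refl
... | true  | true  | false = refl
... | true  | true  | true  = cong signPow (half-suc-even (length p) (∧-conicalˡ _ _ τp))

-- Sums over factorisations w = p s

sumSplits : (List ℤ → List ℤ → ℤ) → List ℤ → ℤ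
sumSplits F []      = F [] []
sumSplits F (x ∷ w) = F [] (x ∷ w) + sumSplits (λ p s → F (x ∷ p) s) w

sumSplits-cong : ∀ {F G : List ℤ → List ℤ → ℤ} → (∀ p s → F p s ≡ G p s) → ∀ w → sumSplits F w ≡ sumSplits G w
sumSplits-cong F≡G []      = F≡G [] []
sumSplits-cong F≡G (x ∷ w) = cong₂ _+_ (F≡G [] (x ∷ w)) (sumSplits-cong (λ p s → F≡G (x ∷ p) s) w)

sumSplits-*ˡ : ∀ k (F : List ℤ → List ℤ → ℤ) w → sumSplits (λ p s → k * F p s) w ≡ k * sumSplits F w
sumSplits-*ˡ k F []      = refl
sumSplits-*ˡ k F (x ∷ w) = begin
  k * F [] (x ∷ w) + sumSplits (λ p s → k * F (x ∷ p) s) w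
    ≡⟨ cong (_+_ (k * F [] (x ∷ w))) (sumSplits-*ˡ k (λ p s → F (x ∷ p) s) w) ⟩
  k * F [] (x ∷ w) + k * sumSplits (λ p s → F (x ∷ p) s) w
    ≡⟨ ℤ.*-distribˡ-+ k (F [] (x ∷ w)) _ ⟨
  k * sumSplits F (x ∷ w) ∎
  where open ≡-Reasoning

sumHeaded : (ℤ → Bool) → (List ℤ → ℤ) → (List ℤ → ℤ) → List ℤ → ℤ
sumHeaded c f g = sumSplits (λ p s → indicator (headAll c p) * (f p * g s))

unlessHead : (ℤ → Bool) → (List ℤ → ℤ) → List ℤ → ℤ
unlessHead c f w = if headAny c w then + 0 else f w

indicator-∧-* : ∀ x y t → indicator (x ∧ y) * t ≡ indicator x * (indicator y * t)
indicator-∧-* true  y t = sym (ℤ.*-identityˡ _)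
indicator-∧-* false y t = refl

sumSplits-factor : ∀ {F : List ℤ → List ℤ → ℤ} k c f g →
                   (∀ p s → F p s ≡ k * (indicator (headAll c p) * (f p * g s))) →
                   ∀ w → sumSplits F w ≡ k * sumHeaded c f g w
sumSplits-factor k c f g F≡ w = trans (sumSplits-cong F≡ w) (sumSplits-*ˡ k _ w)

REven-factor : ∀ (c : ℤ → Bool) a b p t →
  indicator (c a) * (indREven (a ∷ b ∷ p) * t)
  ≡ (indicator (c a) * indicator (isPosNegAscent a b)) * (indicator (headAll (_≺ b) p) * (indREven p * t))
REven-factor c a b p t rewrite isREven-∷∷ a b p =
  trans (cong (indicator (c a) *_) (trans (indicator-∧-* P (H ∧ R) t) (cong (indicator P *_) (indicator-∧-* H R t))))
        (sym (ℤ.*-assoc (indicator (c a)) (indicator P) (indicator H * (indicator R * t))))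
  where P = isPosNegAscent a b
        H = headAll (_≺ b) p
        R = isREven p

tau-factor : ∀ (c : ℤ → Bool) a b p t →
  indicator (c a) * (tauCoeff (a ∷ b ∷ p) * t)
  ≡ (- (indicator (c a) * indicator (isPosNegAscent a b))) * (indicator (headAll (b ≺_) p) * (tauCoeff p * t))
tau-factor c a b p t rewrite tauCoeff-∷∷ a b p with c a | isPosNegAscent a b | headAll (b ≺_) p
... | false | _     | _     = refl
... | true  | false | _     = refl
... | true  | true  | false = refl
... | true  | true  | true  = begin
  + 1 * (- tauCoeff p * t)           ≡⟨ ℤ.*-identityˡ _ ⟩
  - tauCoeff p * t                   ≡⟨ ℤ.neg-distribˡ-* (tauCoeff p) t ⟨
  - (tauCoeff p * t)                 ≡⟨ ℤ.-1*i≡-i _ ⟨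
  - + 1 * (tauCoeff p * t)           ≡⟨ cong (- + 1 *_) (ℤ.*-identityˡ _) ⟨
  - + 1 * (+ 1 * (tauCoeff p * t))   ∎
  where open ≡-Reasoning

-- The terms p = ∅ and p = a of the sum, followed by the remaining terms as given by induction.
REven-tau-boundary : ∀ (c : ℤ → Bool) a b w → All (b #_) w →
  + 1 * (+ 1 * tauCoeff (a ∷ b ∷ w))
    + (indicator (c a) * + 0 + (indicator (c a) * indicator (isPosNegAscent a b)) * unlessHead (_≺ b) tauCoeff w)
  ≡ unlessHead c tauCoeff (a ∷ b ∷ w)
REven-tau-boundary c a b w b#w with c a
... | false = trans (ℤ.+-identityʳ _) (trans (ℤ.*-identityˡ _) (ℤ.*-identityˡ _))
... | true rewrite tauCoeff-∷∷ a b w with isPosNegAscent a b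
...   | false = refl
...   | true with w | b#w
...     | []    | _ = refl
...     | z ∷ r | b#z ∷ _ rewrite <ᵇ-flip {∣ b ∣} {∣ z ∣} b#z with b ≺ z
...       | false = refl
...       | true  = begin
  + 1 * (+ 1 * - τ) + (+ 0 + + 1 * τ)
    ≡⟨ cong₂ _+_ (trans (ℤ.*-identityˡ (+ 1 * - τ)) (ℤ.*-identityˡ (- τ))) (trans (ℤ.+-identityˡ (+ 1 * τ)) (ℤ.*-identityˡ τ)) ⟩
  - τ + τ
    ≡⟨ ℤ.+-inverseˡ τ ⟩
  + 0 ∎
  where open ≡-Reasoning
        τ = tauCoeff (z ∷ r)

tau-REven-boundary : ∀ (c : ℤ → Bool) a b w → All (b #_) w →
  + 1 * (+ 1 * indREven (a ∷ b ∷ w))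
    + (indicator (c a) * + 0 + (- (indicator (c a) * indicator (isPosNegAscent a b))) * unlessHead (b ≺_) indREven w)
  ≡ unlessHead c indREven (a ∷ b ∷ w)
tau-REven-boundary c a b w b#w with c a
... | false = trans (ℤ.+-identityʳ _) (trans (ℤ.*-identityˡ _) (ℤ.*-identityˡ _))
... | true rewrite isREven-∷∷ a b w with isPosNegAscent a b
...   | false = refl
...   | true with w | b#w
...     | []    | _ = refl
...     | z ∷ r | b#z ∷ _ rewrite <ᵇ-flip {∣ b ∣} {∣ z ∣} b#z with b ≺ z | isREven (z ∷ r)
...       | true  | _     = refl
...       | false | true  = refl
...       | false | false = refl

-- The head condition c is what the induction needs: an R_{2n}-shaped a b p′ has p′ starting below |b|.
sumHeaded-REven-tau : ∀ c w → Distinct w → sumHeaded c indREven tauCoeff w ≡ unlessHead c tauCoeff w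
sumHeaded-REven-tau c []          _ = refl
sumHeaded-REven-tau c (a ∷ [])    _ with c a
... | true  = refl
... | false = refl
sumHeaded-REven-tau c (a ∷ b ∷ w) (_ ∷ b#w ∷ dw) =
  trans (cong (λ t → + 1 * (+ 1 * tauCoeff (a ∷ b ∷ w)) + (indicator (c a) * + 0 + t))
              (trans (sumSplits-factor k (_≺ b) indREven tauCoeff (λ p s → REven-factor c a b p (tauCoeff s)) w)
                     (cong (k *_) (sumHeaded-REven-tau (_≺ b) w dw))))
        (REven-tau-boundary c a b w b#w)
  where k = indicator (c a) * indicator (isPosNegAscent a b)

sumHeaded-tau-REven : ∀ c w → Distinct w → sumHeaded c tauCoeff indREven w ≡ unlessHead c indREven w
sumHeaded-tau-REven c []          _ = refl
sumHeaded-tau-REven c (a ∷ [])    _ with c a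
... | true  = refl
... | false = refl
sumHeaded-tau-REven c (a ∷ b ∷ w) (_ ∷ b#w ∷ dw) =
  trans (cong (λ t → + 1 * (+ 1 * indREven (a ∷ b ∷ w)) + (indicator (c a) * + 0 + t))
              (trans (sumSplits-factor k (b ≺_) tauCoeff indREven (λ p s → tau-factor c a b p (indREven s)) w)
                     (cong (k *_) (sumHeaded-tau-REven (b ≺_) w dw))))
        (tau-REven-boundary c a b w b#w)
  where k = - (indicator (c a) * indicator (isPosNegAscent a b))

ROdd-factor : ∀ a p t → indicator (isROdd (a ∷ p)) * t ≡ indicator (isPos a) * (indicator (headAll (_≺ a) p) * (indREven p * t))
ROdd-factor a p t rewrite isROdd-∷ a p =
  trans (indicator-∧-* (isPos a) _ t) (cong (indicator (isPos a) *_) (indicator-∧-* (headAll (_≺ a) p) (isREven p) t))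

ROdd-boundary : ∀ a w → All (a #_) w → indicator (isPos a) * unlessHead (_≺ a) tauCoeff w ≡ rhoCoeff (a ∷ w)
ROdd-boundary a w a#w rewrite rhoCoeff-∷ a w with isPos a
... | false = refl
... | true with w | a#w
...   | []    | _ = refl
...   | z ∷ r | a#z ∷ _ rewrite <ᵇ-flip {∣ a ∣} {∣ z ∣} a#z with a ≺ z
...     | false = refl
...     | true  = ℤ.*-identityˡ _

sumSplits-ROdd-tau : ∀ w → Distinct w → sumSplits (λ p s → indicator (isROdd p) * tauCoeff s) w ≡ rhoCoeff w
sumSplits-ROdd-tau []      _          = refl
sumSplits-ROdd-tau (a ∷ w) (a#w ∷ dw) = begin
  + 0 + sumSplits (λ p s → indicator (isROdd (a ∷ p)) * tauCoeff s) w
    ≡⟨ ℤ.+-identityˡ _ ⟩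
  sumSplits (λ p s → indicator (isROdd (a ∷ p)) * tauCoeff s) w
    ≡⟨ sumSplits-factor (indicator (isPos a)) (_≺ a) indREven tauCoeff (λ p s → ROdd-factor a p (tauCoeff s)) w ⟩
  indicator (isPos a) * sumHeaded (_≺ a) indREven tauCoeff w
    ≡⟨ cong (indicator (isPos a) *_) (sumHeaded-REven-tau (_≺ a) w dw) ⟩
  indicator (isPos a) * unlessHead (_≺ a) tauCoeff w
    ≡⟨ ROdd-boundary a w a#w ⟩
  rhoCoeff (a ∷ w) ∎
  where open ≡-Reasoning

sumHeaded-true : ∀ f g w → sumSplits (λ p s → f p * g s) w ≡ sumHeaded (λ _ → true) f g w
sumHeaded-true f g = sumSplits-cong headAll-true
  where
  headAll-true : ∀ p s → f p * g s ≡ indicator (headAll (λ _ → true) p) * (f p * g s)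
  headAll-true []      s = sym (ℤ.*-identityˡ _)
  headAll-true (_ ∷ _) s = sym (ℤ.*-identityˡ _)

unlessHead-true : ∀ f → f [] ≡ + 1 → ∀ w → unlessHead (λ _ → true) f w ≡ one w
unlessHead-true f f[]≡1 []      = f[]≡1
unlessHead-true f f[]≡1 (_ ∷ _) = refl

-- Standardisation

countBelow : ℕ → List ℤ → ℕ
countBelow k w = length (filter (λ y → ∣ y ∣ ℕ.<? k) w)

countBelow-mono : ∀ w {k k′} → k ≤ k′ → countBelow k w ≤ countBelow k′ w
countBelow-mono []      _    = z≤n
countBelow-mono (y ∷ w) {k} {k′} k≤k′
  with ∣ y ∣ <ᵇ k | ℕ.<ᵇ-reflects-< ∣ y ∣ k | ∣ y ∣ <ᵇ k′ | ℕ.<ᵇ-reflects-< ∣ y ∣ k′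
... | true  | _       | true  | _        = s≤s (countBelow-mono w k≤k′)
... | true  | ofʸ y<k | false | ofⁿ y≮k′ = ⊥-elim (y≮k′ (ℕ.<-≤-trans y<k k≤k′))
... | false | _       | true  | _        = ℕ.m≤n⇒m≤1+n (countBelow-mono w k≤k′)
... | false | _       | false | _        = countBelow-mono w k≤k′

countBelow-strict : ∀ {x w k} → x ∈ w → ∣ x ∣ < k → countBelow ∣ x ∣ w < countBelow k w
countBelow-strict {x} {y ∷ w} {k} x∈yw x<k
  with ∣ y ∣ <ᵇ ∣ x ∣ | ℕ.<ᵇ-reflects-< ∣ y ∣ ∣ x ∣ | ∣ y ∣ <ᵇ k | ℕ.<ᵇ-reflects-< ∣ y ∣ k | x∈yw
... | true  | ofʸ y<x | false | ofⁿ y≮k | _        = ⊥-elim (y≮k (ℕ.<-trans y<x x<k))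
... | false | _       | false | ofⁿ y≮k | here refl = ⊥-elim (y≮k x<k)
... | true  | ofʸ y<x | _     | _       | here refl = ⊥-elim (ℕ.<-irrefl refl y<x)
... | true  | _       | true  | _       | there x∈w = s≤s (countBelow-strict x∈w x<k)
... | false | _       | true  | _       | here refl = s≤s (countBelow-mono w (ℕ.<⇒≤ x<k))
... | false | _       | true  | _       | there x∈w = ℕ.m≤n⇒m≤1+n (countBelow-strict x∈w x<k)
... | false | _       | false | _       | there x∈w = countBelow-strict x∈w x<k

rankAbs≤length : ∀ {x w} → x ∈ w → rankAbs x w ≤ length w
rankAbs≤length {x} {w} x∈w =
  ℕ.<-≤-trans (countBelow-strict x∈w (ℕ.n<1+n ∣ x ∣)) (length-filter (λ y → ∣ y ∣ ℕ.<? suc ∣ x ∣) w)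

rankAbs-<ᵇ : ∀ {x w} y → x ∈ w → (rankAbs x w <ᵇ rankAbs y w) ≡ x ≺ y
rankAbs-<ᵇ {x} {w} y x∈w with ∣ x ∣ <ᵇ ∣ y ∣ | ℕ.<ᵇ-reflects-< ∣ x ∣ ∣ y ∣
... | true  | ofʸ x<y = <ᵇ-true (s≤s (countBelow-strict x∈w x<y))
... | false | ofⁿ x≮y = <ᵇ-false (ℕ.≤⇒≯ (s≤s (countBelow-mono w (ℕ.≮⇒≥ x≮y))))

rankAbs-injective : ∀ {x y w} → x ∈ w → y ∈ w → x # y → rankAbs x w ≢ rankAbs y w
rankAbs-injective {x} {y} x∈w y∈w x#y rx≡ry with ℕ.<-cmp ∣ x ∣ ∣ y ∣
... | tri< x<y _ _ = ℕ.<-irrefl (ℕ.suc-injective rx≡ry) (countBelow-strict x∈w x<y)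
... | tri≈ _ x≡y _ = x#y x≡y
... | tri> _ _ y<x = ℕ.<-irrefl (ℕ.suc-injective (sym rx≡ry)) (countBelow-strict y∈w y<x)

stdLetter : List ℤ → ℤ → ℤ
stdLetter w x = if isPos x then + rankAbs x w else - (+ rankAbs x w)

∣stdLetter∣ : ∀ w x → ∣ stdLetter w x ∣ ≡ rankAbs x w
∣stdLetter∣ w x with isPos x
... | true  = refl
... | false = refl

isPos-stdLetter : ∀ w x → isPos (stdLetter w x) ≡ isPos x
isPos-stdLetter w (+ zero)  = refl
isPos-stdLetter w (+ suc n) = refl
isPos-stdLetter w -[1+ n ]  = refl

upDownOK-map : ∀ (h : ℤ → ℤ) f i v → (∀ {x} y → x ∈ v → h x ≺ h y ≡ x ≺ y) →
               upDownOK f i (map h v) ≡ upDownOK f i v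
upDownOK-map h f i []          _ = refl
upDownOK-map h f i (x ∷ [])    _ = refl
upDownOK-map h f i (x ∷ y ∷ v) h≺ =
  cong₂ _∧_ (cong₂ (if_then_else_ (f i)) (h≺ y (here refl)) (h≺ x (there (here refl))))
            (upDownOK-map h f (suc i) (y ∷ v) (λ z x∈ → h≺ z (there x∈)))

signsOK-map : ∀ (h : ℤ → ℤ) f i v → (∀ x → isPos (h x) ≡ isPos x) → signsOK f i (map h v) ≡ signsOK f i v
signsOK-map h f i []      _    = refl
signsOK-map h f i (x ∷ v) hpos = cong₂ _∧_ (cong (f i ⇔ᵇ_) (hpos x)) (signsOK-map h f (suc i) v hpos)

hasShape-stdS : ∀ len asc pos u → hasShape len asc pos (stdS u) ≡ hasShape len asc pos u
hasShape-stdS len asc pos u =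
  cong₂ _∧_ (cong len (length-map (stdLetter u) u))
            (cong₂ _∧_ (upDownOK-map (stdLetter u) asc 1 u rank-order) (signsOK-map (stdLetter u) pos 1 u (isPos-stdLetter u)))
  where
  rank-order : ∀ {x} y → x ∈ u → stdLetter u x ≺ stdLetter u y ≡ x ≺ y
  rank-order {x} y x∈u rewrite ∣stdLetter∣ u x | ∣stdLetter∣ u y = rankAbs-<ᵇ y x∈u

stdS-distinct : ∀ u → Distinct u → Distinct (stdS u)
stdS-distinct u = AllPairs.map⁺ ∘ distinct-on u (λ x∈ → x∈)
  where
  distinct-on : ∀ v → v ⊆ u → Distinct v → AllPairs (_#_ on stdLetter u) v
  distinct-on []      _   []          = []
  distinct-on (x ∷ v) v⊆u (x#v ∷ dv) =
    All.tabulate (λ {y} y∈v eq → rankAbs-injective (v⊆u (here refl)) (v⊆u (there y∈v)) (All.lookup x#v y∈v)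
                                   (trans (sym (∣stdLetter∣ u x)) (trans eq (∣stdLetter∣ u y))))
    ∷ distinct-on v (v⊆u ∘ there) dv

InRange : ℕ → ℤ → Set
InRange n x = 1 ≤ ∣ x ∣ × ∣ x ∣ ≤ n

stdS-inRange : ∀ u → All (InRange (length (stdS u))) (stdS u)
stdS-inRange u rewrite length-map (stdLetter u) u =
  All.map⁺ (All.tabulate (λ {x} x∈u → subst (λ k → 1 ≤ k × k ≤ length u) (sym (∣stdLetter∣ u x)) (s≤s z≤n , rankAbs≤length x∈u)))

-- Signed permutations

T-allᵇ⁻ : ∀ {A : Set} (p : A → Bool) l → T (allᵇ p l) → All (T ∘ p) l
T-allᵇ⁻ p []      _ = []
T-allᵇ⁻ p (x ∷ l) t = proj₁ (Equivalence.to T-∧ t) ∷ T-allᵇ⁻ p l (proj₂ (Equivalence.to T-∧ t))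

T-allᵇ⁺ : ∀ {A : Set} (p : A → Bool) l → All (T ∘ p) l → T (allᵇ p l)
T-allᵇ⁺ p []      []         = _
T-allᵇ⁺ p (x ∷ l) (px ∷ pl) = Equivalence.from T-∧ (px , T-allᵇ⁺ p l pl)

isSPerm⇒count≡1 : ∀ w → IsSignedPerm w → ∀ i → i < length w → countAbs (suc i) w ≡ 1
isSPerm⇒count≡1 w σ i i<n = ℕ.≡ᵇ⇒≡ _ 1 (All.lookup (T-allᵇ⁻ _ (upTo (length w)) σ) (∈-upTo⁺ i<n))

count≡1⇒isSPerm : ∀ w → (∀ i → i < length w → countAbs (suc i) w ≡ 1) → IsSignedPerm w
count≡1⇒isSPerm w h = T-allᵇ⁺ _ (upTo (length w)) (All.tabulate (λ i∈ → ℕ.≡⇒≡ᵇ _ 1 (h _ (∈-upTo⁻ i∈))))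

-- Pigeonhole through countUpTo n w = Σ_{k=1}^{n} countAbs k w: it is at most length w, with equality
-- iff every letter has absolute value in [1, n]; for distinct absolute values it is at most n, with
-- equality iff each of 1, …, n occurs.  hits n m = Σ_{k=1}^{n} [m = k].
hits : ℕ → ℕ → ℕ
hits zero    m = 0
hits (suc n) m = (if m ≡ᵇ suc n then 1 else 0) ℕ.+ hits n m

countUpTo : ℕ → List ℤ → ℕ
countUpTo zero    w = 0
countUpTo (suc n) w = countAbs (suc n) w ℕ.+ countUpTo n w

hits-out : ∀ n m → ¬ (1 ≤ m × m ≤ n) → hits n m ≡ 0
hits-out zero    m _   = refl
hits-out (suc n) m out with m ℕ.≟ suc n
... | yes refl = ⊥-elim (out (s≤s z≤n , ℕ.≤-refl))
... | no m≢1+n rewrite ≡ᵇ-false m≢1+n = hits-out n m (λ (1≤m , m≤n) → out (1≤m , ℕ.m≤n⇒m≤1+n m≤n))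

hits-in : ∀ n m → 1 ≤ m → m ≤ n → hits n m ≡ 1
hits-in zero    m (s≤s _) ()
hits-in (suc n) m 1≤m m≤1+n with m ℕ.≟ suc n
... | yes refl rewrite ≡ᵇ-true {suc n} refl | hits-out n (suc n) (ℕ.1+n≰n ∘ proj₂) = refl
... | no m≢1+n rewrite ≡ᵇ-false m≢1+n = hits-in n m 1≤m (ℕ.≤-pred (ℕ.≤∧≢⇒< m≤1+n m≢1+n))

hits≤1 : ∀ n m → hits n m ≤ 1
hits≤1 n m with (1 ℕ.≤? m) ×-dec (m ℕ.≤? n)
... | yes (1≤m , m≤n) = ℕ.≤-reflexive (hits-in n m 1≤m m≤n)
... | no out          = subst (_≤ 1) (sym (hits-out n m out)) z≤n

hits≡1⇒inRange : ∀ n m → hits n m ≡ 1 → 1 ≤ m × m ≤ n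
hits≡1⇒inRange n m eq with (1 ℕ.≤? m) ×-dec (m ℕ.≤? n)
... | yes inRange = inRange
... | no out      with () ← trans (sym (hits-out n m out)) eq

countUpTo-[] : ∀ n → countUpTo n [] ≡ 0
countUpTo-[] zero    = refl
countUpTo-[] (suc n) = countUpTo-[] n

countUpTo-∷ : ∀ n x w → countUpTo n (x ∷ w) ≡ hits n ∣ x ∣ ℕ.+ countUpTo n w
countUpTo-∷ zero    x w = refl
countUpTo-∷ (suc n) x w rewrite countUpTo-∷ n x w with ∣ x ∣ ≡ᵇ suc n
... | true  = cong suc (+-exchange (countAbs (suc n) w) (hits n ∣ x ∣) (countUpTo n w))
... | false = +-exchange (countAbs (suc n) w) (hits n ∣ x ∣) (countUpTo n w)

countUpTo≤length : ∀ n w → countUpTo n w ≤ length w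
countUpTo≤length n []      = ℕ.≤-reflexive (countUpTo-[] n)
countUpTo≤length n (x ∷ w) rewrite countUpTo-∷ n x w = ℕ.+-mono-≤ (hits≤1 n ∣ x ∣) (countUpTo≤length n w)

countUpTo≡length⇒inRange : ∀ n w → countUpTo n w ≡ length w → All (InRange n) w
countUpTo≡length⇒inRange n []      _  = []
countUpTo≡length⇒inRange n (x ∷ w) eq rewrite countUpTo-∷ n x w with hits n ∣ x ∣ in hx | hits≤1 n ∣ x ∣
... | zero        | _       = ⊥-elim (ℕ.<-irrefl eq (s≤s (countUpTo≤length n w)))
... | suc zero    | _       = hits≡1⇒inRange n ∣ x ∣ hx ∷ countUpTo≡length⇒inRange n w (ℕ.suc-injective eq)
... | suc (suc _) | s≤s ()

inRange⇒countUpTo≡length : ∀ n w → All (InRange n) w → countUpTo n w ≡ length w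
inRange⇒countUpTo≡length n []      _                 = countUpTo-[] n
inRange⇒countUpTo≡length n (x ∷ w) ((1≤x , x≤n) ∷ r) rewrite countUpTo-∷ n x w | hits-in n ∣ x ∣ 1≤x x≤n =
  cong suc (inRange⇒countUpTo≡length n w r)

countUpTo≤n : ∀ n w → (∀ k → countAbs k w ≤ 1) → countUpTo n w ≤ n
countUpTo≤n zero    w _  = z≤n
countUpTo≤n (suc n) w ≤1 = ℕ.+-mono-≤ (≤1 (suc n)) (countUpTo≤n n w ≤1)

countUpTo≡n⇒count≡1 : ∀ n w → (∀ k → countAbs k w ≤ 1) → countUpTo n w ≡ n → ∀ i → i < n → countAbs (suc i) w ≡ 1
countUpTo≡n⇒count≡1 (suc n) w ≤1 eq i i<1+n with countAbs (suc n) w in c | ≤1 (suc n)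
... | zero     | _ = ⊥-elim (ℕ.<-irrefl eq (s≤s (countUpTo≤n n w ≤1)))
... | suc zero | _ with i ℕ.≟ n
...   | yes refl = c
...   | no i≢n   = countUpTo≡n⇒count≡1 n w ≤1 (ℕ.suc-injective eq) i (ℕ.≤∧≢⇒< (ℕ.≤-pred i<1+n) i≢n)
countUpTo≡n⇒count≡1 (suc n) w ≤1 eq i i<1+n | suc (suc _) | s≤s ()

count≡1⇒countUpTo≡n : ∀ n w → (∀ i → i < n → countAbs (suc i) w ≡ 1) → countUpTo n w ≡ n
count≡1⇒countUpTo≡n zero    w _  = refl
count≡1⇒countUpTo≡n (suc n) w ≡1 rewrite ≡1 n ℕ.≤-refl = cong suc (count≡1⇒countUpTo≡n n w (λ i i<n → ≡1 i (ℕ.m≤n⇒m≤1+n i<n)))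

countAbs-absent : ∀ k w → All (λ y → ∣ y ∣ ≢ k) w → countAbs k w ≡ 0
countAbs-absent k []      _          = refl
countAbs-absent k (x ∷ w) (x≢k ∷ w≢k) rewrite ≡ᵇ-false x≢k = countAbs-absent k w w≢k

countAbs≤1 : ∀ k w → Distinct w → countAbs k w ≤ 1
countAbs≤1 k []      _          = z≤n
countAbs≤1 k (x ∷ w) (x#w ∷ dw) with ∣ x ∣ ℕ.≟ k
... | yes refl rewrite ≡ᵇ-true {∣ x ∣} refl | countAbs-absent ∣ x ∣ w (All.map (_∘ sym) x#w) = ℕ.≤-refl
... | no x≢k   rewrite ≡ᵇ-false x≢k = countAbs≤1 k w dw

countAbs-∷ : ∀ k x w → countAbs k w ≤ countAbs k (x ∷ w)
countAbs-∷ k x w with ∣ x ∣ ≡ᵇ k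
... | true  = ℕ.n≤1+n _
... | false = ℕ.≤-refl

countAbs-member : ∀ {y w} → y ∈ w → 1 ≤ countAbs ∣ y ∣ w
countAbs-member {y} {x ∷ w} (here refl) rewrite ≡ᵇ-true {∣ x ∣} refl = s≤s z≤n
countAbs-member {y} {x ∷ w} (there y∈w) = ℕ.≤-trans (countAbs-member y∈w) (countAbs-∷ ∣ y ∣ x w)

countAbs≤1⇒distinct : ∀ w → (∀ {y} → y ∈ w → countAbs ∣ y ∣ w ≤ 1) → Distinct w
countAbs≤1⇒distinct []      _  = []
countAbs≤1⇒distinct (x ∷ w) ≤1 =
  All.tabulate (λ y∈w x≡y → ℕ.<-irrefl refl (ℕ.<-≤-trans (twice x≡y y∈w) (≤1 (here refl))))
  ∷ countAbs≤1⇒distinct w (λ y∈w → ℕ.≤-trans (countAbs-∷ _ x w) (≤1 (there y∈w)))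
  where
  twice : ∀ {y} → ∣ x ∣ ≡ ∣ y ∣ → y ∈ w → 1 < countAbs ∣ x ∣ (x ∷ w)
  twice {y} x≡y y∈w rewrite ≡ᵇ-true {∣ x ∣} refl = s≤s (subst (λ k → 1 ≤ countAbs k w) (sym x≡y) (countAbs-member y∈w))

isSPerm⇒inRange : ∀ w → IsSignedPerm w → All (InRange (length w)) w
isSPerm⇒inRange w σ = countUpTo≡length⇒inRange _ w (count≡1⇒countUpTo≡n _ w (isSPerm⇒count≡1 w σ))

isSPerm⇒distinct : ∀ w → IsSignedPerm w → Distinct w
isSPerm⇒distinct w σ = countAbs≤1⇒distinct w count≤1
  where
  count≤1 : ∀ {y} → y ∈ w → countAbs ∣ y ∣ w ≤ 1
  count≤1 {y} y∈w with ∣ y ∣ | All.lookup (isSPerm⇒inRange w σ) y∈w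
  ... | suc i | _ , 1+i≤n = ℕ.≤-reflexive (isSPerm⇒count≡1 w σ i 1+i≤n)

distinct∧inRange⇒isSPerm : ∀ w → Distinct w → All (InRange (length w)) w → IsSignedPerm w
distinct∧inRange⇒isSPerm w dw r =
  count≡1⇒isSPerm w (countUpTo≡n⇒count≡1 _ w (λ k → countAbs≤1 k w dw) (inRange⇒countUpTo≡length _ w r))

stdS-isSPerm : ∀ u → Distinct u → IsSignedPerm (stdS u)
stdS-isSPerm u du = distinct∧inRange⇒isSPerm (stdS u) (stdS-distinct u du) (stdS-inRange u)

-- τ_{2m} and ρ_{2m+1} among signed permutations

signed : (ℕ → Bool) → ℕ → ℤ
signed pos k = if pos k then + k else - (+ k)

signedFrom : (ℕ → Bool) → ℕ → ℕ → List ℤ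
signedFrom pos k zero    = []
signedFrom pos k (suc n) = signed pos k ∷ signedFrom pos (suc k) n

applyUpTo≡signedFrom : ∀ pos k n (h : ℕ → ℤ) → (∀ i → h i ≡ signed pos (k ℕ.+ i)) → applyUpTo h n ≡ signedFrom pos k n
applyUpTo≡signedFrom pos k zero    h h≡ = refl
applyUpTo≡signedFrom pos k (suc n) h h≡ =
  cong₂ _∷_ (trans (h≡ 0) (cong (signed pos) (ℕ.+-identityʳ k)))
            (applyUpTo≡signedFrom pos (suc k) n (h ∘ suc) (λ i → trans (h≡ (suc i)) (cong (signed pos) (ℕ.+-suc k i))))

tau≡signedFrom : ∀ m → tau m ≡ signedFrom oddᵇ 1 (2 ℕ.* m)
tau≡signedFrom m = trans (map-applyUpTo id _ (2 ℕ.* m)) (applyUpTo≡signedFrom oddᵇ 1 (2 ℕ.* m) _ letter)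
  where
  letter : ∀ i → (if evenᵇ (suc i) then - (+ suc i) else + suc i) ≡ signed oddᵇ (suc i)
  letter i with evenᵇ (suc i)
  ... | true  = refl
  ... | false = refl

rho≡signedFrom : ∀ m → rho m ≡ signedFrom rhoSigns 1 (suc (2 ℕ.* m))
rho≡signedFrom m = trans (map-applyUpTo id _ (suc (2 ℕ.* m))) (applyUpTo≡signedFrom rhoSigns 1 (suc (2 ℕ.* m)) _ letter)
  where
  letter : ∀ i → (if oddᵇ (suc i) ∧ (2 <ᵇ suc i) then - (+ suc i) else + suc i) ≡ signed rhoSigns (suc i)
  letter zero          = refl
  letter (suc zero)    = refl
  letter (suc (suc j)) with evenᵇ (suc j)
  ... | true  = refl
  ... | false = refl

length-signedFrom : ∀ pos k n → length (signedFrom pos k n) ≡ n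
length-signedFrom pos k zero    = refl
length-signedFrom pos k (suc n) = cong suc (length-signedFrom pos (suc k) n)

∣signed∣ : ∀ pos k → ∣ signed pos k ∣ ≡ k
∣signed∣ pos k with pos k
... | true  = refl
... | false = ℤ.∣-i∣≡∣i∣ (+ k)

signedFrom-increasing : ∀ pos k i n → T (upDownOK (λ _ → true) i (signedFrom pos k n))
signedFrom-increasing pos k i zero          = _
signedFrom-increasing pos k i (suc zero)    = _
signedFrom-increasing pos k i (suc (suc n)) =
  Equivalence.from T-∧ (subst₂ (λ a b → T (a <ᵇ b)) (sym (∣signed∣ pos k)) (sym (∣signed∣ pos (suc k))) (ℕ.<⇒<ᵇ (ℕ.n<1+n k))
                       , signedFrom-increasing pos (suc k) (suc i) (suc n))

signedFrom-signs : ∀ pos k n → T (signsOK pos (suc k) (signedFrom pos (suc k) n))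
signedFrom-signs pos k zero    = _
signedFrom-signs pos k (suc n) = Equivalence.from T-∧ (sign-ok , signedFrom-signs pos (suc k) n)
  where
  sign-ok : T (pos (suc k) ⇔ᵇ isPos (signed pos (suc k)))
  sign-ok with pos (suc k)
  ... | true  = _
  ... | false = _

signedFrom-hasShape : ∀ len pos n → T (len n) → T (hasShape len (λ _ → true) pos (signedFrom pos 1 n))
signedFrom-hasShape len pos n ln =
  Equivalence.from T-∧ (subst (T ∘ len) (sym (length-signedFrom pos 1 n)) ln
                       , Equivalence.from T-∧ (signedFrom-increasing pos 1 1 n , signedFrom-signs pos 0 n))

Sorted : List ℤ → Set
Sorted = AllPairs (_<_ on ∣_∣)

increasing⇒sorted : ∀ i v → T (upDownOK (λ _ → true) i v) → Sorted v
increasing⇒sorted i v = Linked⇒AllPairs ℕ.<-trans ∘ linked i v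
  where
  linked : ∀ i v → T (upDownOK (λ _ → true) i v) → Linked (_<_ on ∣_∣) v
  linked i []          _ = []
  linked i (x ∷ [])    _ = [-]
  linked i (x ∷ y ∷ v) t =
    ℕ.<ᵇ⇒< ∣ x ∣ ∣ y ∣ (proj₁ (Equivalence.to T-∧ t)) ∷ linked (suc i) (y ∷ v) (proj₂ (Equivalence.to T-∧ t))

sorted-run : ∀ {b} x v → Sorted (x ∷ v) → All (λ y → ∣ y ∣ < b) (x ∷ v) → ∣ x ∣ ℕ.+ length (x ∷ v) ≤ b
sorted-run {b} x []      _                   (x<b ∷ []) = subst (_≤ b) (ℕ.+-comm 1 ∣ x ∣) x<b
sorted-run {b} x (y ∷ v) ((x<y ∷ _) ∷ sorted) (_ ∷ y∷v<b) = begin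
  ∣ x ∣ ℕ.+ suc (length (y ∷ v))   ≡⟨ ℕ.+-suc ∣ x ∣ (length (y ∷ v)) ⟩
  suc ∣ x ∣ ℕ.+ length (y ∷ v)     ≤⟨ ℕ.+-monoˡ-≤ (length (y ∷ v)) x<y ⟩
  ∣ y ∣ ℕ.+ length (y ∷ v)         ≤⟨ sorted-run y v sorted y∷v<b ⟩
  b                               ∎
  where open ℕ.≤-Reasoning

signed-unique : ∀ pos x k → ∣ x ∣ ≡ k → T (pos k ⇔ᵇ isPos x) → x ≡ signed pos k
signed-unique pos (+ zero)  .0       refl _ with pos 0
... | true  = refl
... | false = refl
signed-unique pos (+ suc n) .(suc n) refl _ with pos (suc n)
... | true  = refl
signed-unique pos -[1+ n ]  .(suc n) refl _ with pos (suc n)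
... | false = refl

sorted⇒signedFrom : ∀ pos k v → Sorted v → All (λ y → k ≤ ∣ y ∣ × ∣ y ∣ < k ℕ.+ length v) v →
                    T (signsOK pos k v) → v ≡ signedFrom pos k (length v)
sorted⇒signedFrom pos k []      _                    _                   _ = refl
sorted⇒signedFrom pos k (x ∷ v) sorted@(x<v ∷ sv) range@((k≤x , _) ∷ rv) t =
  cong₂ _∷_ (signed-unique pos x k ∣x∣≡k (proj₁ (Equivalence.to T-∧ t)))
            (sorted⇒signedFrom pos (suc k) v sv range′ (proj₂ (Equivalence.to T-∧ t)))
  where
  ∣x∣≡k : ∣ x ∣ ≡ k
  ∣x∣≡k = ℕ.≤-antisym (ℕ.+-cancelʳ-≤ (length (x ∷ v)) ∣ x ∣ k
                        (sorted-run x v sorted (All.map (λ (_ , y<) → y<) range))) k≤x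
  range′ : All (λ y → suc k ≤ ∣ y ∣ × ∣ y ∣ < suc k ℕ.+ length v) v
  range′ = All.zipWith (λ {y} (x<y , _ , y<) → subst (_< ∣ y ∣) ∣x∣≡k x<y , subst (∣ y ∣ <_) (ℕ.+-suc k (length v)) y<)
                       (x<v , rv)

shape⇒signedFrom : ∀ len pos v → IsSignedPerm v → T (hasShape len (λ _ → true) pos v) → v ≡ signedFrom pos 1 (length v)
shape⇒signedFrom len pos v σ t with Equivalence.to (T-∧ {len (length v)}) t
... | _ , t′ with Equivalence.to (T-∧ {upDownOK (λ _ → true) 1 v}) t′
...   | increasing , signs =
  sorted⇒signedFrom pos 1 v (increasing⇒sorted 1 v increasing)
                    (All.map (λ (1≤y , y≤n) → 1≤y , s≤s y≤n) (isSPerm⇒inRange v σ)) signs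

evenᵇ-double : ∀ m → T (evenᵇ (2 ℕ.* m))
evenᵇ-double zero    = _
evenᵇ-double (suc m) = subst (T ∘ evenᵇ) (sym (ℕ.*-suc 2 m)) (evenᵇ-double m)

double-half-even : ∀ n → T (evenᵇ n) → 2 ℕ.* half n ≡ n
double-half-even zero          _ = refl
double-half-even (suc (suc n)) e = trans (ℕ.*-suc 2 (half n)) (cong (suc ∘ suc) (double-half-even n e))

double-half-odd : ∀ n → T (oddᵇ n) → suc (2 ℕ.* half n) ≡ n
double-half-odd (suc zero)    _ = refl
double-half-odd (suc (suc n)) o = trans (cong suc (ℕ.*-suc 2 (half n))) (cong (suc ∘ suc) (double-half-odd n o))

isTau-tau : ∀ m → T (isTau (tau m))
isTau-tau m = subst (T ∘ isTau) (sym (tau≡signedFrom m)) (signedFrom-hasShape evenᵇ oddᵇ (2 ℕ.* m) (evenᵇ-double m))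

isRho-rho : ∀ m → T (isRho (rho m))
isRho-rho m = subst (T ∘ isRho) (sym (rho≡signedFrom m))
                    (signedFrom-hasShape oddᵇ rhoSigns (suc (2 ℕ.* m)) (subst T (sym (oddᵇ-suc (2 ℕ.* m))) (evenᵇ-double m)))

isTau⇒≡tau : ∀ v → IsSignedPerm v → T (isTau v) → v ≡ tau (half (length v))
isTau⇒≡tau v σ t = begin
  v                                         ≡⟨ shape⇒signedFrom evenᵇ oddᵇ v σ t ⟩
  signedFrom oddᵇ 1 (length v)              ≡⟨ cong (signedFrom oddᵇ 1) (double-half-even (length v) even) ⟨
  signedFrom oddᵇ 1 (2 ℕ.* half (length v)) ≡⟨ tau≡signedFrom (half (length v)) ⟨
  tau (half (length v))                     ∎
  where open ≡-Reasoning
        even = proj₁ (Equivalence.to T-∧ t)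

isRho⇒≡rho : ∀ v → IsSignedPerm v → T (isRho v) → v ≡ rho (half (length v))
isRho⇒≡rho v σ t = begin
  v                                                   ≡⟨ shape⇒signedFrom oddᵇ rhoSigns v σ t ⟩
  signedFrom rhoSigns 1 (length v)                    ≡⟨ cong (signedFrom rhoSigns 1) (double-half-odd (length v) odd) ⟨
  signedFrom rhoSigns 1 (suc (2 ℕ.* half (length v))) ≡⟨ rho≡signedFrom (half (length v)) ⟨
  rho (half (length v))                               ∎
  where open ≡-Reasoning
        odd = proj₁ (Equivalence.to T-∧ t)

series-sperm : ∀ (s : ℕ → List ℤ) (P : List ℤ → Bool) → (∀ m → T (P (s m))) →
               (∀ v → IsSignedPerm v → T (P v) → v ≡ s (half (length v))) →
               ∀ v → IsSignedPerm v →
               (if v == s (half (length v)) then signPow (half (length v)) else + 0)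
               ≡ (if P v then signPow (half (length v)) else + 0)
series-sperm s P P-s P⇒≡s v σ with ≡-dec ℤ._≟_ v (s (half (length v))) | P v in Pv
... | yes _    | true  = refl
... | no  _    | false = refl
... | yes v≡s  | false = ⊥-elim (subst T (trans (cong P (sym v≡s)) Pv) (P-s (half (length v))))
... | no  v≢s  | true  = ⊥-elim (v≢s (P⇒≡s v σ (subst T (sym Pv) _)))

TauSeries-sperm : ∀ v → IsSignedPerm v → TauSeries v ≡ tauCoeff v
TauSeries-sperm = series-sperm tau isTau isTau-tau isTau⇒≡tau

RhoSeries-sperm : ∀ v → IsSignedPerm v → RhoSeries v ≡ rhoCoeff v
RhoSeries-sperm = series-sperm rho isRho isRho-rho isRho⇒≡rho

-- Products at signed permutations

sumℤ-splits : ∀ F w → sumℤ (applyUpTo (λ k → F (take k w) (drop k w)) (suc (length w))) ≡ sumSplits F w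
sumℤ-splits F []      = ℤ.+-identityʳ (F [] [])
sumℤ-splits F (x ∷ w) = cong (_+_ (F [] (x ∷ w))) (sumℤ-splits (λ p s → F (x ∷ p) s) w)

⋆≡sumSplits : ∀ (A B : FQSym2) (f g : List ℤ → ℤ) →
             (∀ u → Distinct u → A (stdS u) ≡ f u) → (∀ u → Distinct u → B (stdS u) ≡ g u) →
             ∀ w → Distinct w → (A ⋆ B) w ≡ sumSplits (λ p s → f p * g s) w
⋆≡sumSplits A B f g A≡f B≡g w dw = begin
  (A ⋆ B) w
    ≡⟨ cong sumℤ (map-cong (λ k → cong₂ _*_ (A≡f _ (AllPairs.take⁺ k dw)) (B≡g _ (AllPairs.drop⁺ k dw))) (upTo (suc (length w)))) ⟩
  sumℤ (map (λ k → f (take k w) * g (drop k w)) (upTo (suc (length w))))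
    ≡⟨ cong sumℤ (map-applyUpTo id (λ k → f (take k w) * g (drop k w)) (suc (length w))) ⟩
  sumℤ (applyUpTo (λ k → f (take k w) * g (drop k w)) (suc (length w)))
    ≡⟨ sumℤ-splits (λ p s → f p * g s) w ⟩
  sumSplits (λ p s → f p * g s) w ∎
  where open ≡-Reasoning

V-stdS : ∀ u → Distinct u → V (stdS u) ≡ indREven u
V-stdS u du = cong indicator (cong₂ _∧_ (Equivalence.to T-≡ (stdS-isSPerm u du)) (hasShape-stdS evenᵇ oddᵇ oddᵇ u))

W-stdS : ∀ u → Distinct u → W (stdS u) ≡ indicator (isROdd u)
W-stdS u du = cong indicator (cong₂ _∧_ (Equivalence.to T-≡ (stdS-isSPerm u du)) (hasShape-stdS oddᵇ evenᵇ rhoSigns u))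

TauSeries-stdS : ∀ u → Distinct u → TauSeries (stdS u) ≡ tauCoeff u
TauSeries-stdS u du =
  trans (TauSeries-sperm (stdS u) (stdS-isSPerm u du))
        (cong₂ (λ b n → if b then signPow (half n) else + 0) (hasShape-stdS evenᵇ (λ _ → true) oddᵇ u) (length-map (stdLetter u) u))

V⋆TauSeries≈one : (V ⋆ TauSeries) ≈ one
V⋆TauSeries≈one w σ = begin
  (V ⋆ TauSeries) w                             ≡⟨ ⋆≡sumSplits V TauSeries indREven tauCoeff V-stdS TauSeries-stdS w dw ⟩
  sumSplits (λ p s → indREven p * tauCoeff s) w ≡⟨ sumHeaded-true indREven tauCoeff w ⟩
  sumHeaded (λ _ → true) indREven tauCoeff w    ≡⟨ sumHeaded-REven-tau (λ _ → true) w dw ⟩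
  unlessHead (λ _ → true) tauCoeff w            ≡⟨ unlessHead-true tauCoeff refl w ⟩
  one w                                         ∎
  where open ≡-Reasoning
        dw = isSPerm⇒distinct w σ

TauSeries⋆V≈one : (TauSeries ⋆ V) ≈ one
TauSeries⋆V≈one w σ = begin
  (TauSeries ⋆ V) w                             ≡⟨ ⋆≡sumSplits TauSeries V tauCoeff indREven TauSeries-stdS V-stdS w dw ⟩
  sumSplits (λ p s → tauCoeff p * indREven s) w ≡⟨ sumHeaded-true tauCoeff indREven w ⟩
  sumHeaded (λ _ → true) tauCoeff indREven w    ≡⟨ sumHeaded-tau-REven (λ _ → true) w dw ⟩
  unlessHead (λ _ → true) indREven w            ≡⟨ unlessHead-true indREven refl w ⟩
  one w                                         ∎
  where open ≡-Reasoning
        dw = isSPerm⇒distinct w σ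

W⋆TauSeries≈RhoSeries : (W ⋆ TauSeries) ≈ RhoSeries
W⋆TauSeries≈RhoSeries w σ = begin
  (W ⋆ TauSeries) w                                        ≡⟨ ⋆≡sumSplits W TauSeries (indicator ∘ isROdd) tauCoeff W-stdS TauSeries-stdS w dw ⟩
  sumSplits (λ p s → indicator (isROdd p) * tauCoeff s) w  ≡⟨ sumSplits-ROdd-tau w dw ⟩
  rhoCoeff w                                               ≡⟨ RhoSeries-sperm w σ ⟨
  RhoSeries w                                              ∎
  where open ≡-Reasoning
        dw = isSPerm⇒distinct w σ

proposition6p4 : ((V ⋆ TauSeries) ≈ one × (TauSeries ⋆ V) ≈ one) × (W ⋆ TauSeries) ≈ RhoSeries
proposition6p4 = (V⋆TauSeries≈one , TauSeries⋆V≈one) , W⋆TauSeries≈RhoSeries
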